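{- Let $T\in\mathrm{PG}(1,E)\setminus\mathrm{PG}(1,F)$. Then $Th=Tk$ for all $h,k\in\mathbb{F}_{q^t}^*$ with $h^{ -1}k\in\mathbb{F}_q$. Furthermore, if $T$ is a scattered point, then $Th$ and $Tk$ are distant for all $h,k\in\mathbb{F}_{q^t}^*$ with $h^{ -1}k\notin\mathbb{F}_q$.
   Context: Let $q$ be a prime power, $t\ge 2$, and $E=\mathrm{End}_{\mathbb{F}_q}(\mathbb{F}_{q^t})$, the ring of $\mathbb{F}_q$-linear maps $\mathbb{F}_{q^t}\to\mathbb{F}_{q^t}$. Maps are written on the right, $x\mapsto x^\alpha$, and composed left to right, i.e. $x^{\alpha\beta}=(x^\alpha)^\beta$. Let $\mathbb{1}$ be the identity map and $E^*$ the group of units of $E$. For $a\in\mathbb{F}_{q^t}$ let $\rho_a\in E$ be $x\mapsto ax$, and $F=\{\rho_a: a\in\mathbb{F}_{q^t}\}$. $E^2$ is regarded as a left $E$-module of row vectors, on which $\mathrm{GL}_2(E)$ acts from the right. A pair $(\alpha,\beta)\in E^2$ is admissible if it is the first row of a matrix in $\mathrm{GL}_2(E)$. The projective line $\mathrm{PG}(1,E)$ is the set of cyclic submodules $E(\alpha,\beta)$ with $(\alpha,\beta)$ admissible (its elements are called points); $E(\alpha,\beta)=E(\alpha',\beta')$ iff $(\alpha',\beta')=(\gamma\alpha,\gamma\beta)$ for some $\gamma\in E^*$. Two points $E(\alpha,\beta),E(\gamma,\delta)$ are distant if the $2\times 2$ matrix with rows $(\alpha,\beta)$ and $(\gamma,\delta)$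 lies in $\mathrm{GL}_2(E)$, and non-distant otherwise. $\mathrm{PG}(1,F)$ denotes the subset $\{E(\rho_a,\rho_b): (a,b)\in\mathbb{F}_{q^t}^2\setminus\{(0,0)\}\}$ of $\mathrm{PG}(1,E)$. For a point $T=E(\alpha,\beta)$ and $h\in\mathbb{F}_{q^t}^*$ put $Th=E(\alpha\rho_h,\beta\rho_h)$. Let $L_T$ be the set of points of $\mathrm{PG}(1,F)$ that are non-distant to $T$. Put $\theta_{t-1}=(q^t-1)/(q-1)$. A point $T$ is scattered if $|L_T|=\theta_{t-1}$. -}

module Defs where

open import Level using (_⊔_)
open import Algebra.Bundles using (CommutativeRing)
open import Data.Nat as ℕ using (ℕ; zero; suc; _≥_)
open import Data.Nat.Primality using (Prime)
open import Data.Fin using (Fin)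
open import Data.Product using (Σ; ∃; ∃-syntax; _×_; _,_)
open import Relation.Nullary using (¬_)
open import Relation.Binary.PropositionalEquality using (_≡_)
import Relation.Binary.Reasoning.Setoid as SetoidReasoning

-- θ_{t-1} = (q^t - 1)/(q - 1) = 1 + q + ... + q^(t-1)
θ : ℕ → ℕ → ℕ
θ q zero    = 0
θ q (suc t) = q ℕ.^ t ℕ.+ θ q t

IsPrimePower : ℕ → Set
IsPrimePower q = ∃[ p ] ∃[ n ] (Prime p × n ≥ 1 × q ≡ p ℕ.^ n)

-- Everything below is relative to a commutative ring K (which will be
-- assumed to be the field F_{q^t}) and the natural number q.
module Setup {c ℓ} (K : CommutativeRing c ℓ) (q : ℕ) where
  open CommutativeRing K

  infixr 8 _^ᴷ_
  _^ᴷ_ : Carrier → ℕ → Carrier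
  x ^ᴷ zero  = 1#
  x ^ᴷ suc n = x * (x ^ᴷ n)

  IsField : Set (c ⊔ ℓ)
  IsField = (¬ (1# ≈ 0#)) × (∀ x → ¬ (x ≈ 0#) → ∃[ y ] (x * y ≈ 1#))

  HasCard : ℕ → Set (c ⊔ ℓ)
  HasCard n = Σ (Fin n → Carrier) λ e →
    (∀ i j → e i ≈ e j → i ≡ j) × (∀ x → ∃[ i ] (e i ≈ x))

  -- the subfield F_q of F_{q^t}: the elements with x^q = x
  InFq : Carrier → Set ℓ
  InFq x = x ^ᴷ q ≈ x

  -- E = End_{F_q}(F_{q^t}): F_q-linear maps, written on the right
  record Lin : Set (c ⊔ ℓ) where
    field
      app   : Carrier → Carrier
      cong  : ∀ {x y} → x ≈ y → app x ≈ app y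
      add   : ∀ x y → app (x + y) ≈ app x + app y
      scal  : ∀ a x → InFq a → app (a * x) ≈ a * app x
  open Lin public

  infix 4 _≈E_
  _≈E_ : Lin → Lin → Set (c ⊔ ℓ)
  α ≈E β = ∀ x → app α x ≈ app β x

  -- composition left to right: x^(αβ) = (x^α)^β
  infixl 7 _·_
  _·_ : Lin → Lin → Lin
  app (α · β) x = app β (app α x)
  cong (α · β) e = cong β (cong α e)
  add (α · β) x y = trans (cong β (add α x y)) (add β (app α x) (app α y))
  scal (α · β) a x h = trans (cong β (scal α a x h)) (scal β a (app α x) h)

  infixl 6 _⊕_
  _⊕_ : Lin → Lin → Lin
  app (α ⊕ β) x = app α x + app β x
  cong (α ⊕ β) e = +-cong (cong α e) (cong β e)
  add (α ⊕ β) x y = begin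
      app α (x + y) + app β (x + y)
    ≈⟨ +-cong (add α x y) (add β x y) ⟩
      (app α x + app α y) + (app β x + app β y)
    ≈⟨ +-assoc (app α x) (app α y) _ ⟩
      app α x + (app α y + (app β x + app β y))
    ≈⟨ +-congˡ (sym (+-assoc (app α y) (app β x) (app β y))) ⟩
      app α x + ((app α y + app β x) + app β y)
    ≈⟨ +-congˡ (+-congʳ (+-comm (app α y) (app β x))) ⟩
      app α x + ((app β x + app α y) + app β y)
    ≈⟨ +-congˡ (+-assoc (app β x) (app α y) (app β y)) ⟩
      app α x + (app β x + (app α y + app β y))
    ≈⟨ sym (+-assoc (app α x) (app β x) _) ⟩
      (app α x + app β x) + (app α y + app β y)
    ∎
    where open SetoidReasoning setoid
  scal (α ⊕ β) a x h =
    trans (+-cong (scal α a x h) (scal β a x h)) (sym (distribˡ a (app α x) (app β x)))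

  0E : Lin
  app 0E x = 0#
  cong 0E _ = refl
  add 0E x y = sym (+-identityˡ 0#)
  scal 0E a x h = sym (zeroʳ a)

  𝟙 : Lin
  app 𝟙 x = x
  cong 𝟙 e = e
  add 𝟙 x y = refl
  scal 𝟙 a x h = refl

  ρ : Carrier → Lin
  app (ρ a) x = a * x
  cong (ρ a) e = *-congˡ e
  add (ρ a) x y = distribˡ a x y
  scal (ρ a) b x h = begin
      a * (b * x)   ≈⟨ sym (*-assoc a b x) ⟩
      (a * b) * x   ≈⟨ *-congʳ (*-comm a b) ⟩
      (b * a) * x   ≈⟨ *-assoc b a x ⟩
      b * (a * x)   ∎
    where open SetoidReasoning setoid

  IsUnit : Lin → Set (c ⊔ ℓ)
  IsUnit α = ∃[ β ] (α · β ≈E 𝟙 × β · α ≈E 𝟙)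

  record Mat : Set (c ⊔ ℓ) where
    constructor mat
    field
      m11 m12 m21 m22 : Lin
  open Mat public

  _⊗_ : Mat → Mat → Mat
  mat a b c' d ⊗ mat e f g h = mat (a · e ⊕ b · g) (a · f ⊕ b · h)
                                   (c' · e ⊕ d · g) (c' · f ⊕ d · h)

  I₂ : Mat
  I₂ = mat 𝟙 0E 0E 𝟙

  _≈M_ : Mat → Mat → Set (c ⊔ ℓ)
  M ≈M N = (m11 M ≈E m11 N) × (m12 M ≈E m12 N) × (m21 M ≈E m21 N) × (m22 M ≈E m22 N)

  InGL₂ : Mat → Set (c ⊔ ℓ)
  InGL₂ M = ∃[ N ] ((M ⊗ N) ≈M I₂ × (N ⊗ M) ≈M I₂)

  Pair : Set (c ⊔ ℓ)
  Pair = Lin × Lin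

  Admissible : Pair → Set (c ⊔ ℓ)
  Admissible (α , β) = ∃[ γ ] ∃[ δ ] InGL₂ (mat α β γ δ)

  -- E(α,β) = E(α',β') : (α',β') = (γα, γβ) with γ ∈ E*
  SamePoint : Pair → Pair → Set (c ⊔ ℓ)
  SamePoint (α , β) (α' , β') = ∃[ γ ] (IsUnit γ × α' ≈E γ · α × β' ≈E γ · β)

  Distant : Pair → Pair → Set (c ⊔ ℓ)
  Distant (α , β) (γ , δ) = InGL₂ (mat α β γ δ)

  NonZeroPair : Carrier × Carrier → Set ℓ
  NonZeroPair (a , b) = ¬ (a ≈ 0# × b ≈ 0#)

  ρ² : Carrier × Carrier → Pair
  ρ² (a , b) = (ρ a , ρ b)

  InPGF : Pair → Set (c ⊔ ℓ)
  InPGF T = ∃[ ab ] (NonZeroPair ab × SamePoint T (ρ² ab))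

  InL : Pair → Carrier × Carrier → Set (c ⊔ ℓ)
  InL T ab = NonZeroPair ab × ¬ Distant T (ρ² ab)

  CardL : Pair → ℕ → Set (c ⊔ ℓ)
  CardL T n = Σ (Fin n → Carrier × Carrier) λ f →
      (∀ i → InL T (f i))
    × (∀ i j → SamePoint (ρ² (f i)) (ρ² (f j)) → i ≡ j)
    × (∀ ab → InL T ab → ∃[ i ] SamePoint (ρ² ab) (ρ² (f i)))

  Scattered : ℕ → Pair → Set (c ⊔ ℓ)
  Scattered t T = CardL T (θ q t)

  _⟨_⟩ : Pair → Carrier → Pair
  (α , β) ⟨ h ⟩ = (α · ρ h , β · ρ h)

-- Write image T x = (x^α, x^β) for T = E(α,β). This map is F_q-linear and injective (T is
-- admissible), and the points of L_T are exactly the E(ρ_u, ρ_v) with (u,v) = image T x, x ≠ 0.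
-- If l = h⁻¹k lies in F_q, the unit ρ_l carries Th to Tk. If Th and Tk are not distant, a
-- nonzero kernel vector of the matrix with rows Th, Tk gives units x, y with
-- image T x = l · image T y. When T is scattered, each of its Θ = θ_{t-1} points is the image of
-- the q - 1 distinct F_q^*-multiples of a representative unit; if l ∉ F_q, the point of y is
-- also the image of x, which is not such a multiple of y. That gives 1 + Θ(q - 1) = q^t units,
-- one more than F_{q^t} has. The bound |F_q^*| ≥ q - 1 inside the given field comes from
-- x^(q^t - 1) = 1 and a root count.

module Submission where

open import Defs
open import Algebra.Bundles using (CommutativeRing; AbelianGroup)
import Algebra.Construct.DirectProduct as DirectProduct
import Algebra.Properties.AbelianGroup as AbelianGroupProperties
import Algebra.Properties.CommutativeMonoid.Sum as ProductProperties
import Algebra.Properties.CommutativeSemigroup as CommutativeSemigroupProperties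
import Algebra.Properties.Monoid.Mult as PowerProperties
import Algebra.Properties.Ring as RingProperties
import Algebra.Solver.Ring.NaturalCoefficients.Default as Solver
open import Data.Empty using (⊥-elim)
open import Data.Fin as Fin using (Fin; zero; suc; punchIn; punchOut; inject≤; combine; remQuot)
open import Data.Fin.Permutation using (Permutation′; permutation)
open import Data.Fin.Properties
  using (¬Fin0; 0≢1+n; suc-injective; any?; injective⇒≤; punchIn-injective; punchInᵢ≢i; punchOut-injective;
         punchIn-punchOut; inject≤-injective; combine-remQuot; remQuot-combine)
open import Data.Nat as ℕ using (ℕ; _≥_; _^_; z≤n; s≤s)
import Data.Nat.Properties as ℕ
open import Data.Nat.Primality using (prime⇒nonZero)
open import Data.Nat.Solver using (module +-*-Solver)
open import Data.Product using (Σ; _×_; _,_; proj₁; proj₂; ∃; ∃-syntax; uncurry; map)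
open import Function using (_∘_; Injective)
open import Level using (_⊔_)
open import Relation.Binary.PropositionalEquality as ≡ using (_≡_; _≢_)
open import Relation.Nullary using (¬_; yes; no; Dec; _×-dec_)
open import Relation.Nullary.Decidable using (¬?; decidable-stable; map′)
open import Relation.Unary using (Pred; Decidable)
import Relation.Binary.Reasoning.Setoid as SetoidReasoning

-- Counting in Fin n

count : ∀ {p n} {P : Pred (Fin n) p} → Decidable P → ℕ
count {n = ℕ.zero} P? = 0
count {n = ℕ.suc n} P? with P? zero
... | yes _ = ℕ.suc (count (P? ∘ suc))
... | no _  = count (P? ∘ suc)

select : ∀ {p n} {P : Pred (Fin n) p} (P? : Decidable P) → Fin (count P?) → Fin n
select {n = ℕ.suc n} P? i with P? zero
select {n = ℕ.suc n} P? zero    | yes _ = zero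
select {n = ℕ.suc n} P? (suc i) | yes _ = suc (select (P? ∘ suc) i)
select {n = ℕ.suc n} P? i       | no _  = suc (select (P? ∘ suc) i)

select-sound : ∀ {p n} {P : Pred (Fin n) p} (P? : Decidable P) i → P (select P? i)
select-sound {n = ℕ.suc n} P? i with P? zero
select-sound {n = ℕ.suc n} P? zero    | yes P0 = P0
select-sound {n = ℕ.suc n} P? (suc i) | yes _  = select-sound (P? ∘ suc) i
select-sound {n = ℕ.suc n} P? i       | no _   = select-sound (P? ∘ suc) i

select-injective : ∀ {p n} {P : Pred (Fin n) p} (P? : Decidable P) → Injective _≡_ _≡_ (select P?)
select-injective {n = ℕ.suc n} P? {i} {j} eq with P? zero
select-injective {n = ℕ.suc n} P? {zero}  {zero}  eq | yes _ = ≡.refl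
select-injective {n = ℕ.suc n} P? {suc i} {suc j} eq | yes _ =
  ≡.cong suc (select-injective (P? ∘ suc) (suc-injective eq))
select-injective {n = ℕ.suc n} P? eq | no _ = select-injective (P? ∘ suc) (suc-injective eq)

count+count-¬ : ∀ {p n} {P : Pred (Fin n) p} (P? : Decidable P) → count P? ℕ.+ count (¬? ∘ P?) ≡ n
count+count-¬ {n = ℕ.zero} P? = ≡.refl
count+count-¬ {n = ℕ.suc n} P? with P? zero
... | yes _ = ≡.cong ℕ.suc (count+count-¬ (P? ∘ suc))
... | no _  = ≡.trans (ℕ.+-suc _ _) (≡.cong ℕ.suc (count+count-¬ (P? ∘ suc)))

injective⇒surjective : ∀ {n} (f : Fin n → Fin n) → Injective _≡_ _≡_ f → ∀ j → ∃ λ i → f i ≡ j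
injective⇒surjective {ℕ.suc n} f f-injective j with any? (λ i → f i Fin.≟ j)
... | yes found  = found
... | no missing = ⊥-elim (ℕ.1+n≰n (injective⇒≤ {f = punchOut ∘ j≢f}
                     (f-injective ∘ punchOut-injective (j≢f _) (j≢f _))))
  where
  j≢f : ∀ i → j ≢ f i
  j≢f i j≡fi = missing (i , ≡.sym j≡fi)

remQuot-injective : ∀ {m} k → Injective _≡_ _≡_ (remQuot {m} k)
remQuot-injective {m} k {a} {b} eq = begin
  a                              ≡⟨ combine-remQuot {m} k a ⟨
  uncurry combine (remQuot {m} k a) ≡⟨ ≡.cong (uncurry combine) eq ⟩
  uncurry combine (remQuot {m} k b) ≡⟨ combine-remQuot {m} k b ⟩
  b                              ∎
  where open ≡.≡-Reasoning

module _ {c ℓ} (K : CommutativeRing c ℓ) (q : ℕ) where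
  open CommutativeRing K hiding (zero)
  open Setup K q
  open RingProperties ring
    using (-‿involutive; -0#≈0#; x+x≈x⇒x≈0; -‿distribˡ-*; -‿distribʳ-*; +-inverseˡ-unique; +-inverseʳ-unique;
           +-cancelʳ; x∙y⁻¹≈ε⇒x≈y)
  open CommutativeSemigroupProperties +-commutativeSemigroup using (interchange)
  open PowerProperties *-monoid using (×-congʳ; ×-assocˡ) renaming (_×_ to _×ᴹ_)
  open Solver commutativeSemiring using (solve; _:+_; _:*_; _:=_; con)
  module ∏ = ProductProperties *-commutativeMonoid

  ^ᴷ≈×ᴹ : ∀ x n → x ^ᴷ n ≈ n ×ᴹ x
  ^ᴷ≈×ᴹ x ℕ.zero    = refl
  ^ᴷ≈×ᴹ x (ℕ.suc n) = *-congˡ (^ᴷ≈×ᴹ x n)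

  ^ᴷ-* : ∀ x m n → (x ^ᴷ m) ^ᴷ n ≈ x ^ᴷ (n ℕ.* m)
  ^ᴷ-* x m n = begin
    (x ^ᴷ m) ^ᴷ n    ≈⟨ ^ᴷ≈×ᴹ (x ^ᴷ m) n ⟩
    n ×ᴹ (x ^ᴷ m)    ≈⟨ ×-congʳ n (^ᴷ≈×ᴹ x m) ⟩
    n ×ᴹ (m ×ᴹ x)    ≈⟨ ×-assocˡ x n m ⟩
    (n ℕ.* m) ×ᴹ x   ≈⟨ ^ᴷ≈×ᴹ x (n ℕ.* m) ⟨
    x ^ᴷ (n ℕ.* m)   ∎
    where open SetoidReasoning setoid

  ^ᴷ-cong : ∀ {x y} n → x ≈ y → x ^ᴷ n ≈ y ^ᴷ n
  ^ᴷ-cong ℕ.zero    x≈y = refl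
  ^ᴷ-cong (ℕ.suc n) x≈y = *-cong x≈y (^ᴷ-cong n x≈y)

  InFq-resp : ∀ {x y} → x ≈ y → InFq x → InFq y
  InFq-resp {x} {y} x≈y x∈Fq = trans (^ᴷ-cong q (sym x≈y)) (trans x∈Fq x≈y)

  -- Polynomial functions

  Monic : ℕ → (Carrier → Carrier) → Set (c ⊔ ℓ)
  Monic ℕ.zero    f = ∀ x → f x ≈ 1#
  Monic (ℕ.suc d) f = ∃[ g ] ∃[ a ] (Monic d g × ∀ x → f x ≈ x * g x + a)

  Monic-resp : ∀ d {f f'} → (∀ x → f x ≈ f' x) → Monic d f → Monic d f'
  Monic-resp ℕ.zero    f≈f' f-monic x = trans (sym (f≈f' x)) (f-monic x)
  Monic-resp (ℕ.suc d) f≈f' (g , a , g-monic , f≈) = g , a , g-monic , λ x → trans (sym (f≈f' x)) (f≈ x)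

  Monic-x^ : ∀ m d {f} → Monic d f → Monic (m ℕ.+ d) (λ x → x ^ᴷ m * f x)
  Monic-x^ ℕ.zero    d f-monic = Monic-resp d (λ x → sym (*-identityˡ _)) f-monic
  Monic-x^ (ℕ.suc m) d {f} f-monic =
    _ , 0# , Monic-x^ m d f-monic , λ x → trans (*-assoc x (x ^ᴷ m) (f x)) (sym (+-identityʳ _))

  Monic-+-const : ∀ d {f} → Monic (ℕ.suc d) f → ∀ b → Monic (ℕ.suc d) (λ x → f x + b)
  Monic-+-const d (g , a , g-monic , f≈) b = g , a + b , g-monic , λ x → trans (+-congʳ (f≈ x)) (+-assoc _ _ _)

  -- The factor theorem f x - f r = (x - r) g x, with both sides moved so that no subtraction occurs.
  Monic-factor : ∀ d {f} → Monic (ℕ.suc d) f → ∀ r →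
                 ∃[ g ] (Monic d g × ∀ x → f x + r * g x ≈ x * g x + f r)
  Monic-factor ℕ.zero {f} (g , a , g-monic , f≈) r = g , g-monic , λ x → begin
    f x + r * g x            ≈⟨ +-congʳ (f≈ x) ⟩
    (x * g x + a) + r * g x  ≈⟨ solve 3 (λ X a R → (X :+ a) :+ R := X :+ (R :+ a)) refl (x * g x) a (r * g x) ⟩
    x * g x + (r * g x + a)  ≈⟨ +-congˡ (+-congʳ (*-congˡ (trans (g-monic x) (sym (g-monic r))))) ⟩
    x * g x + (r * g r + a)  ≈⟨ +-congˡ (f≈ r) ⟨
    x * g x + f r            ∎
    where open SetoidReasoning setoid
  Monic-factor (ℕ.suc d) {f} (g , a , g-monic , f≈) r with Monic-factor d g-monic r
  ... | h , h-monic , g≈ = (λ x → g x + r * h x) , (h , g r , h-monic , g≈) , λ x → begin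
    f x + r * (g x + r * h x)               ≈⟨ +-cong (f≈ x) (*-congˡ (g≈ x)) ⟩
    (x * g x + a) + r * (x * h x + g r)     ≈⟨ solve 6 (λ x G H a r Gr →
                                                  (x :* G :+ a) :+ r :* (x :* H :+ Gr) :=
                                                  x :* (G :+ r :* H) :+ (r :* Gr :+ a))
                                                refl x (g x) (h x) a r (g r) ⟩
    x * (g x + r * h x) + (r * g r + a)     ≈⟨ +-congˡ (f≈ r) ⟨
    x * (g x + r * h x) + f r               ∎
    where open SetoidReasoning setoid

  geometric : ℕ → ℕ → Carrier → Carrier
  geometric r ℕ.zero    x = 0#
  geometric r (ℕ.suc j) x = x ^ᴷ r * geometric r j x + 1#

  geometric-monic : ∀ r j → Monic (j ℕ.* ℕ.suc r) (geometric (ℕ.suc r) (ℕ.suc j))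
  geometric-monic r ℕ.zero    x = trans (+-congʳ (zeroʳ _)) (+-identityˡ 1#)
  geometric-monic r (ℕ.suc j) =
    Monic-+-const (r ℕ.+ j ℕ.* ℕ.suc r) (Monic-x^ (ℕ.suc r) (j ℕ.* ℕ.suc r) (geometric-monic r j)) 1#

  geometric-telescopes : ∀ r j x → geometric r j x * x ^ᴷ r + 1# ≈ geometric r j x + (x ^ᴷ r) ^ᴷ j
  geometric-telescopes r ℕ.zero    x = +-congʳ (zeroˡ _)
  geometric-telescopes r (ℕ.suc j) x = begin
    (y * G + 1#) * y + 1#   ≈⟨ solve 2 (λ y G → (y :* G :+ con 1) :* y :+ con 1 :=
                                               y :* (G :* y :+ con 1) :+ con 1) refl y G ⟩
    y * (G * y + 1#) + 1#   ≈⟨ +-congʳ (*-congˡ (geometric-telescopes r j x)) ⟩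
    y * (G + y ^ᴷ j) + 1#   ≈⟨ solve 3 (λ y G Y → y :* (G :+ Y) :+ con 1 := (y :* G :+ con 1) :+ y :* Y)
                                     refl y G (y ^ᴷ j) ⟩
    (y * G + 1#) + y * y ^ᴷ j ∎
    where
    open SetoidReasoning setoid
    y G : Carrier
    y = x ^ᴷ r
    G = geometric r j x

  -x≈0⇒x≈0 : ∀ {x} → - x ≈ 0# → x ≈ 0#
  -x≈0⇒x≈0 {x} -x≈0 = trans (sym (-‿involutive x)) (trans (-‿cong -x≈0) -0#≈0#)

  app-0# : ∀ α → app α 0# ≈ 0#
  app-0# α = x+x≈x⇒x≈0 (app α 0#) (trans (sym (add α 0# 0#)) (cong α (+-identityʳ 0#)))

  app-‿ : ∀ α x → app α (- x) ≈ - app α x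
  app-‿ α x = +-inverseʳ-unique (app α x) (app α (- x))
    (trans (sym (add α x (- x))) (trans (cong α (-‿inverseʳ x)) (app-0# α)))

  app-+-interchange : ∀ α γ x x' y y' →
    app α (x + x') + app γ (y + y') ≈ (app α x + app γ y) + (app α x' + app γ y')
  app-+-interchange α γ x x' y y' = trans (+-cong (add α x x') (add γ y y')) (interchange _ _ _ _)

  -- 2 × 2 matrices over E acting on K²

  K² : Set c
  K² = Carrier × Carrier

  K²-abelianGroup : AbelianGroup c ℓ
  K²-abelianGroup = DirectProduct.abelianGroup +-abelianGroup +-abelianGroup

  open AbelianGroup K²-abelianGroup using ()
    renaming (_≈_ to _≈₂_; _∙_ to _+₂_; ε to 0₂; _⁻¹ to -₂_; ∙-cong to +₂-cong; setoid to K²-setoid;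
              reflexive to ≈₂-reflexive; sym to ≈₂-sym; trans to ≈₂-trans)
  module K²-Properties = AbelianGroupProperties K²-abelianGroup

  infixr 7 _∙₂_
  _∙₂_ : Carrier → K² → K²
  a ∙₂ (x , y) = (a * x , a * y)

  ∙₂-zeroˡ : ∀ {a z} → a ≈ 0# → a ∙₂ z ≈₂ 0₂
  ∙₂-zeroˡ a≈0 = trans (*-congʳ a≈0) (zeroˡ _) , trans (*-congʳ a≈0) (zeroˡ _)

  ∙₂-zeroʳ : ∀ {a z} → z ≈₂ 0₂ → a ∙₂ z ≈₂ 0₂
  ∙₂-zeroʳ {a} (x≈0 , y≈0) = trans (*-congˡ x≈0) (zeroʳ a) , trans (*-congˡ y≈0) (zeroʳ a)

  infixl 7 _·ᵥ_
  _·ᵥ_ : K² → Mat → K²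
  (x , y) ·ᵥ M = (app (m11 M) x + app (m21 M) y , app (m12 M) x + app (m22 M) y)

  record IsLinear₂ (Φ : K² → K²) : Set (c ⊔ ℓ) where
    field
      cong₂       : ∀ {z z'} → z ≈₂ z' → Φ z ≈₂ Φ z'
      additive    : ∀ z z' → Φ (z +₂ z') ≈₂ Φ z +₂ Φ z'
      homogeneous : ∀ a z → InFq a → Φ (a ∙₂ z) ≈₂ a ∙₂ Φ z

  ·ᵥ-isLinear₂ : ∀ M → IsLinear₂ (_·ᵥ M)
  ·ᵥ-isLinear₂ (mat α β γ δ) = record
    { cong₂       = λ (x≈ , y≈) → +-cong (cong α x≈) (cong γ y≈) , +-cong (cong β x≈) (cong δ y≈)
    ; additive    = λ (x , y) (x' , y') → app-+-interchange α γ x x' y y' , app-+-interchange β δ x x' y y'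
    ; homogeneous = λ a (x , y) a∈Fq →
        trans (+-cong (scal α a x a∈Fq) (scal γ a y a∈Fq)) (sym (distribˡ a _ _)) ,
        trans (+-cong (scal β a x a∈Fq) (scal δ a y a∈Fq)) (sym (distribˡ a _ _))
    }

  ·ᵥ-⊗ : ∀ M N z → z ·ᵥ (M ⊗ N) ≈₂ (z ·ᵥ M) ·ᵥ N
  ·ᵥ-⊗ (mat α β γ δ) (mat α' β' γ' δ') (x , y) =
    sym (app-+-interchange α' γ' (app α x) (app γ y) (app β x) (app δ y)) ,
    sym (app-+-interchange β' δ' (app α x) (app γ y) (app β x) (app δ y))

  ·ᵥ-I₂ : ∀ z → z ·ᵥ I₂ ≈₂ z
  ·ᵥ-I₂ (x , y) = +-identityʳ x , +-identityˡ y

  ·ᵥ-respʳ-≈M : ∀ {M N} → M ≈M N → ∀ z → z ·ᵥ M ≈₂ z ·ᵥ N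
  ·ᵥ-respʳ-≈M (α≈ , β≈ , γ≈ , δ≈) (x , y) = +-cong (α≈ x) (γ≈ y) , +-cong (β≈ x) (δ≈ y)

  0₂-·ᵥ : ∀ M → 0₂ ·ᵥ M ≈₂ 0₂
  0₂-·ᵥ (mat α β γ δ) = trans (+-cong (app-0# α) (app-0# γ)) (+-identityʳ 0#) ,
                        trans (+-cong (app-0# β) (app-0# δ)) (+-identityʳ 0#)

  embed₁-·ᵥ : ∀ M x → (x , 0#) ·ᵥ M ≈₂ (app (m11 M) x , app (m12 M) x)
  embed₁-·ᵥ (mat α β γ δ) x = trans (+-congˡ (app-0# γ)) (+-identityʳ _) ,
                             trans (+-congˡ (app-0# δ)) (+-identityʳ _)

  embed₂-·ᵥ : ∀ M y → (0# , y) ·ᵥ M ≈₂ (app (m21 M) y , app (m22 M) y)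
  embed₂-·ᵥ (mat α β γ δ) y = trans (+-congʳ (app-0# α)) (+-identityˡ _) ,
                             trans (+-congʳ (app-0# β)) (+-identityˡ _)

  ·ᵥ-injective-on-Mat : ∀ {M N} → (∀ z → z ·ᵥ M ≈₂ z ·ᵥ N) → M ≈M N
  ·ᵥ-injective-on-Mat {M} {N} same =
    (λ x → proj₁ (row₁ x)) , (λ x → proj₂ (row₁ x)) , (λ y → proj₁ (row₂ y)) , (λ y → proj₂ (row₂ y))
    where
    row₁ : ∀ x → (app (m11 M) x , app (m12 M) x) ≈₂ (app (m11 N) x , app (m12 N) x)
    row₁ x = ≈₂-trans (≈₂-sym (embed₁-·ᵥ M x)) (≈₂-trans (same (x , 0#)) (embed₁-·ᵥ N x))
    row₂ : ∀ y → (app (m21 M) y , app (m22 M) y) ≈₂ (app (m21 N) y , app (m22 N) y)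
    row₂ y = ≈₂-trans (≈₂-sym (embed₂-·ᵥ M y)) (≈₂-trans (same (0# , y)) (embed₂-·ᵥ N y))

  invertible⇒kernel-trivial : ∀ M → InGL₂ M → ∀ z → z ·ᵥ M ≈₂ 0₂ → z ≈₂ 0₂
  invertible⇒kernel-trivial M (N , M⊗N≈I₂ , _) z z·M≈0 = begin
    z                ≈⟨ ·ᵥ-I₂ z ⟨
    z ·ᵥ I₂          ≈⟨ ·ᵥ-respʳ-≈M {M ⊗ N} {I₂} M⊗N≈I₂ z ⟨
    z ·ᵥ (M ⊗ N)     ≈⟨ ·ᵥ-⊗ M N z ⟩
    (z ·ᵥ M) ·ᵥ N    ≈⟨ IsLinear₂.cong₂ (·ᵥ-isLinear₂ N) z·M≈0 ⟩
    0₂ ·ᵥ N          ≈⟨ 0₂-·ᵥ N ⟩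
    0₂               ∎
    where open SetoidReasoning K²-setoid

  record IsLinearInto (f : Carrier → K²) : Set (c ⊔ ℓ) where
    field
      cong′        : ∀ {x y} → x ≈ y → f x ≈₂ f y
      additive′    : ∀ x y → f (x + y) ≈₂ f x +₂ f y
      homogeneous′ : ∀ a x → InFq a → f (a * x) ≈₂ a ∙₂ f x
  open IsLinearInto

  proj₁ₗ proj₂ₗ : ∀ {f} → IsLinearInto f → Lin
  app  (proj₁ₗ {f} _) x   = proj₁ (f x)
  cong (proj₁ₗ f-lin) x≈y = proj₁ (cong′ f-lin x≈y)
  add  (proj₁ₗ f-lin) x y = proj₁ (additive′ f-lin x y)
  scal (proj₁ₗ f-lin) a x a∈Fq = proj₁ (homogeneous′ f-lin a x a∈Fq)
  app  (proj₂ₗ {f} _) x   = proj₂ (f x)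
  cong (proj₂ₗ f-lin) x≈y = proj₂ (cong′ f-lin x≈y)
  add  (proj₂ₗ f-lin) x y = proj₂ (additive′ f-lin x y)
  scal (proj₂ₗ f-lin) a x a∈Fq = proj₂ (homogeneous′ f-lin a x a∈Fq)

  embed₁-isLinearInto : IsLinearInto (λ x → (x , 0#))
  embed₁-isLinearInto = record
    { cong′        = λ x≈y → x≈y , refl
    ; additive′    = λ _ _ → refl , sym (+-identityʳ 0#)
    ; homogeneous′ = λ a _ _ → refl , sym (zeroʳ a)
    }

  embed₂-isLinearInto : IsLinearInto (λ y → (0# , y))
  embed₂-isLinearInto = record
    { cong′        = λ x≈y → refl , x≈y
    ; additive′    = λ _ _ → sym (+-identityʳ 0#) , refl
    ; homogeneous′ = λ a _ _ → sym (zeroʳ a) , refl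
    }

  ∘-isLinearInto : ∀ {Φ f} → IsLinear₂ Φ → IsLinearInto f → IsLinearInto (Φ ∘ f)
  ∘-isLinearInto {Φ} {f} Φ-linear f-lin = record
    { cong′        = cong₂ ∘ cong′ f-lin
    ; additive′    = λ x y → ≈₂-trans (cong₂ (additive′ f-lin x y)) (additive (f x) (f y))
    ; homogeneous′ = λ a x a∈Fq → ≈₂-trans (cong₂ (homogeneous′ f-lin a x a∈Fq)) (homogeneous a (f x) a∈Fq)
    }
    where open IsLinear₂ Φ-linear

  module _ {Φ : K² → K²} (Φ-linear : IsLinear₂ Φ) where
    open IsLinear₂ Φ-linear

    kernel-trivial⇒injective : (∀ z → Φ z ≈₂ 0₂ → z ≈₂ 0₂) → ∀ {z z'} → Φ z ≈₂ Φ z' → z ≈₂ z'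
    kernel-trivial⇒injective trivial {z} {z'} Φz≈Φz' =
      K²-Properties.x∙y⁻¹≈ε⇒x≈y z z' (trivial (z +₂ -₂ z') (K²-Properties.identityˡ-unique _ (Φ z') (begin
        Φ (z +₂ -₂ z') +₂ Φ z'  ≈⟨ additive (z +₂ -₂ z') z' ⟨
        Φ (z +₂ -₂ z' +₂ z')    ≈⟨ cong₂ (K²-Properties.//-rightDividesˡ z' z) ⟩
        Φ z                     ≈⟨ Φz≈Φz' ⟩
        Φ z'                    ∎)))
      where open SetoidReasoning K²-setoid

    section-isLinear₂ : (∀ {z z'} → Φ z ≈₂ Φ z' → z ≈₂ z') →
                        ∀ {Ψ} → (∀ w → Φ (Ψ w) ≈₂ w) → IsLinear₂ Ψ
    section-isLinear₂ injective {Ψ} ΦΨ≈id = record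
      { cong₂       = λ {w} {w'} w≈w' → injective (≈₂-trans (ΦΨ≈id w) (≈₂-trans w≈w' (≈₂-sym (ΦΨ≈id w'))))
      ; additive    = λ w w' → injective (begin
          Φ (Ψ (w +₂ w'))        ≈⟨ ΦΨ≈id (w +₂ w') ⟩
          w +₂ w'                ≈⟨ +₂-cong (ΦΨ≈id w) (ΦΨ≈id w') ⟨
          Φ (Ψ w) +₂ Φ (Ψ w')    ≈⟨ additive (Ψ w) (Ψ w') ⟨
          Φ (Ψ w +₂ Ψ w')        ∎)
      ; homogeneous = λ a w a∈Fq → injective (begin
          Φ (Ψ (a ∙₂ w))         ≈⟨ ΦΨ≈id (a ∙₂ w) ⟩
          a ∙₂ w                 ≈⟨ *-congˡ (proj₁ (ΦΨ≈id w)) , *-congˡ (proj₂ (ΦΨ≈id w)) ⟨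
          a ∙₂ Φ (Ψ w)           ≈⟨ homogeneous a (Ψ w) a∈Fq ⟨
          Φ (a ∙₂ Ψ w)           ∎)
      }
      where open SetoidReasoning K²-setoid

    matrixOf : Mat
    matrixOf = mat (proj₁ₗ column₁) (proj₂ₗ column₁) (proj₁ₗ column₂) (proj₂ₗ column₂)
      where
      column₁ : IsLinearInto (λ x → Φ (x , 0#))
      column₁ = ∘-isLinearInto Φ-linear embed₁-isLinearInto
      column₂ : IsLinearInto (λ y → Φ (0# , y))
      column₂ = ∘-isLinearInto Φ-linear embed₂-isLinearInto

    ·ᵥ-matrixOf : ∀ z → z ·ᵥ matrixOf ≈₂ Φ z
    ·ᵥ-matrixOf (x , y) =
      ≈₂-trans (≈₂-sym (additive (x , 0#) (0# , y))) (cong₂ (+-identityʳ x , +-identityˡ y))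

  image : Pair → Carrier → K²
  image (α , β) x = (app α x , app β x)

  image-cong : ∀ T {x y} → x ≈ y → image T x ≈₂ image T y
  image-cong (α , β) x≈y = cong α x≈y , cong β x≈y

  image-homogeneous : ∀ T a x → InFq a → image T (a * x) ≈₂ a ∙₂ image T x
  image-homogeneous (α , β) a x a∈Fq = scal α a x a∈Fq , scal β a x a∈Fq

  image-0# : ∀ T {x} → x ≈ 0# → image T x ≈₂ 0₂
  image-0# (α , β) x≈0 = trans (cong α x≈0) (app-0# α) , trans (cong β x≈0) (app-0# β)

  image-kernel : ∀ T → Admissible T → ∀ {x} → image T x ≈₂ 0₂ → x ≈ 0#
  image-kernel (α , β) (γ , δ , invertible) {x} image≈0 =
    proj₁ (invertible⇒kernel-trivial (mat α β γ δ) invertible (x , 0#)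
            (≈₂-trans (embed₁-·ᵥ (mat α β γ δ) x) image≈0))

  image-⟨⟩-kernel : ∀ α β {h h⁻¹ k x y} → h * h⁻¹ ≈ 1# →
                    (x , y) ·ᵥ mat (α · ρ h) (β · ρ h) (α · ρ k) (β · ρ k) ≈₂ 0₂ →
                    image (α , β) x ≈₂ (h⁻¹ * k) ∙₂ image (α , β) (- y)
  image-⟨⟩-kernel α β {h} {h⁻¹} {k} {x} {y} hh⁻¹≈1 (α-eq , β-eq) = solve-for α α-eq , solve-for β β-eq
    where
    solve-for : ∀ γ → h * app γ x + k * app γ y ≈ 0# → app γ x ≈ h⁻¹ * k * app γ (- y)
    solve-for γ eq = begin
      app γ x                   ≈⟨ *-identityˡ _ ⟨
      1# * app γ x              ≈⟨ *-congʳ (trans (*-comm h⁻¹ h) hh⁻¹≈1) ⟨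
      h⁻¹ * h * app γ x         ≈⟨ *-assoc h⁻¹ h _ ⟩
      h⁻¹ * (h * app γ x)       ≈⟨ *-congˡ (+-inverseˡ-unique _ _ eq) ⟩
      h⁻¹ * - (k * app γ y)     ≈⟨ *-congˡ (-‿distribʳ-* k (app γ y)) ⟩
      h⁻¹ * (k * - app γ y)     ≈⟨ *-assoc h⁻¹ k _ ⟨
      h⁻¹ * k * - app γ y       ≈⟨ *-congˡ (app-‿ γ y) ⟨
      h⁻¹ * k * app γ (- y)     ∎
      where open SetoidReasoning setoid

  module _ (isField : IsField) where
    1≉0 : ¬ 1# ≈ 0#
    1≉0 = proj₁ isField

    _⁻¹[_] : ∀ x → ¬ x ≈ 0# → Carrier
    x ⁻¹[ x≉0 ] = proj₁ (proj₂ isField x x≉0)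

    *-inverseʳ : ∀ x (x≉0 : ¬ x ≈ 0#) → x * x ⁻¹[ x≉0 ] ≈ 1#
    *-inverseʳ x x≉0 = proj₂ (proj₂ isField x x≉0)

    *-inverseˡ : ∀ x (x≉0 : ¬ x ≈ 0#) → x ⁻¹[ x≉0 ] * x ≈ 1#
    *-inverseˡ x x≉0 = trans (*-comm _ x) (*-inverseʳ x x≉0)

    *-cancelʳ : ∀ {a b c} → ¬ c ≈ 0# → a * c ≈ b * c → a ≈ b
    *-cancelʳ {a} {b} {c} c≉0 ac≈bc = begin
      a                      ≈⟨ *-identityʳ a ⟨
      a * 1#                 ≈⟨ *-congˡ (*-inverseʳ c c≉0) ⟨
      a * (c * c ⁻¹[ c≉0 ])  ≈⟨ *-assoc a c _ ⟨
      a * c * c ⁻¹[ c≉0 ]    ≈⟨ *-congʳ ac≈bc ⟩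
      b * c * c ⁻¹[ c≉0 ]    ≈⟨ *-assoc b c _ ⟩
      b * (c * c ⁻¹[ c≉0 ])  ≈⟨ *-congˡ (*-inverseʳ c c≉0) ⟩
      b * 1#                 ≈⟨ *-identityʳ b ⟩
      b                      ∎
      where open SetoidReasoning setoid

    *-cancelˡ : ∀ {a b c} → ¬ c ≈ 0# → c * a ≈ c * b → a ≈ b
    *-cancelˡ {a} {b} {c} c≉0 ca≈cb = *-cancelʳ c≉0 (trans (*-comm a c) (trans ca≈cb (*-comm c b)))

    x*y≈0⇒y≈0 : ∀ {x y} → ¬ x ≈ 0# → x * y ≈ 0# → y ≈ 0#
    x*y≈0⇒y≈0 {x} x≉0 xy≈0 = *-cancelˡ x≉0 (trans xy≈0 (sym (zeroʳ x)))

    *-≉0 : ∀ {x y} → ¬ x ≈ 0# → ¬ y ≈ 0# → ¬ x * y ≈ 0#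
    *-≉0 x≉0 y≉0 xy≈0 = y≉0 (x*y≈0⇒y≈0 x≉0 xy≈0)

    ⁻¹-≉0 : ∀ {x} (x≉0 : ¬ x ≈ 0#) → ¬ x ⁻¹[ x≉0 ] ≈ 0#
    ⁻¹-≉0 {x} x≉0 x⁻¹≈0 = 1≉0 (trans (sym (*-inverseʳ x x≉0)) (trans (*-congˡ x⁻¹≈0) (zeroʳ x)))

    x*z≈y*z⇒x≉y⇒z≈0 : ∀ {x y z} → x * z ≈ y * z → ¬ x ≈ y → z ≈ 0#
    x*z≈y*z⇒x≉y⇒z≈0 {x} {y} {z} xz≈yz x≉y = x*y≈0⇒y≈0 x-y≉0 (begin
      (x - y) * z       ≈⟨ distribʳ z x (- y) ⟩
      x * z + - y * z   ≈⟨ +-congˡ (-‿distribˡ-* y z) ⟨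
      x * z - y * z     ≈⟨ +-congʳ xz≈yz ⟩
      y * z - y * z     ≈⟨ -‿inverseʳ (y * z) ⟩
      0#                ∎)
      where
      open SetoidReasoning setoid
      x-y≉0 : ¬ x - y ≈ 0#
      x-y≉0 x-y≈0 = x≉y (x∙y⁻¹≈ε⇒x≈y x y x-y≈0)

    Monic-roots≤degree : ∀ d {f} → Monic d f → ∀ {m} (a : Fin m → Carrier) →
                         Injective _≡_ _≈_ a → (∀ i → f (a i) ≈ 0#) → m ℕ.≤ d
    Monic-roots≤degree d _ {ℕ.zero} _ _ _ = z≤n
    Monic-roots≤degree ℕ.zero f-monic {ℕ.suc m} a _ roots =
      ⊥-elim (1≉0 (trans (sym (f-monic (a zero))) (roots zero)))
    Monic-roots≤degree (ℕ.suc d) {f} f-monic {ℕ.suc m} a a-injective roots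
      with Monic-factor d f-monic (a zero)
    ... | g , g-monic , f≈ =
      s≤s (Monic-roots≤degree d g-monic (a ∘ suc) (suc-injective ∘ a-injective) g-roots)
      where
      g-roots : ∀ i → g (a (suc i)) ≈ 0#
      g-roots i = x*z≈y*z⇒x≉y⇒z≈0 (begin
          r * g y            ≈⟨ +-identityˡ _ ⟨
          0# + r * g y       ≈⟨ +-congʳ (roots (suc i)) ⟨
          f y + r * g y      ≈⟨ f≈ y ⟩
          y * g y + f r      ≈⟨ +-congˡ (roots zero) ⟩
          y * g y + 0#       ≈⟨ +-identityʳ _ ⟩
          y * g y            ∎)
        (λ r≈y → 0≢1+n (a-injective r≈y))
        where
        open SetoidReasoning setoid
        r y : Carrier
        r = a zero
        y = a (suc i)

    ρ-isUnit : ∀ {a} → ¬ a ≈ 0# → IsUnit (ρ a)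
    ρ-isUnit {a} a≉0 = ρ (a ⁻¹[ a≉0 ]) , cancel (*-inverseˡ a a≉0) , cancel (*-inverseʳ a a≉0)
      where
      cancel : ∀ {b c} → b * c ≈ 1# → ∀ x → b * (c * x) ≈ x
      cancel {b} {c} bc≈1 x = trans (sym (*-assoc b c x)) (trans (*-congʳ bc≈1) (*-identityˡ x))

    x*y≈1⇒y≉0 : ∀ {x y} → x * y ≈ 1# → ¬ y ≈ 0#
    x*y≈1⇒y≉0 {x} xy≈1 y≈0 = 1≉0 (trans (sym xy≈1) (trans (*-congˡ y≈0) (zeroʳ x)))

    samePoint-⟨⟩ : ∀ T {h h⁻¹ k} → ¬ k ≈ 0# → h * h⁻¹ ≈ 1# → InFq (h⁻¹ * k) →
                   SamePoint (T ⟨ h ⟩) (T ⟨ k ⟩)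
    samePoint-⟨⟩ (α , β) {h} {h⁻¹} {k} k≉0 hh⁻¹≈1 l∈Fq =
      ρ l , ρ-isUnit (*-≉0 (x*y≈1⇒y≉0 hh⁻¹≈1) k≉0) , shift α , shift β
      where
      l : Carrier
      l = h⁻¹ * k
      shift : ∀ γ x → k * app γ x ≈ h * app γ (l * x)
      shift γ x = begin
        k * app γ x          ≈⟨ *-congʳ (*-identityˡ k) ⟨
        1# * k * app γ x     ≈⟨ *-congʳ (*-congʳ hh⁻¹≈1) ⟨
        h * h⁻¹ * k * app γ x ≈⟨ *-congʳ (*-assoc h h⁻¹ k) ⟩
        h * l * app γ x      ≈⟨ *-assoc h l (app γ x) ⟩
        h * (l * app γ x)    ≈⟨ *-congˡ (scal γ l x l∈Fq) ⟨
        h * app γ (l * x)    ∎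
        where open SetoidReasoning setoid

    infix 4 _∼_
    _∼_ : K² → K² → Set (c ⊔ ℓ)
    z ∼ z' = ∃[ a ] (¬ a ≈ 0# × z' ≈₂ a ∙₂ z)

    ≈₂⇒∼ : ∀ {z z'} → z ≈₂ z' → z ∼ z'
    ≈₂⇒∼ (x≈ , y≈) = 1# , 1≉0 , trans (sym x≈) (sym (*-identityˡ _)) , trans (sym y≈) (sym (*-identityˡ _))

    ∼-sym : ∀ {z z'} → z ∼ z' → z' ∼ z
    ∼-sym (a , a≉0 , x'≈ , y'≈) = a ⁻¹[ a≉0 ] , ⁻¹-≉0 a≉0 , unscale x'≈ , unscale y'≈
      where
      unscale : ∀ {u u'} → u' ≈ a * u → u ≈ a ⁻¹[ a≉0 ] * u'
      unscale {u} {u'} u'≈au = begin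
        u                           ≈⟨ *-identityˡ u ⟨
        1# * u                      ≈⟨ *-congʳ (*-inverseˡ a a≉0) ⟨
        a ⁻¹[ a≉0 ] * a * u         ≈⟨ *-assoc _ a u ⟩
        a ⁻¹[ a≉0 ] * (a * u)       ≈⟨ *-congˡ u'≈au ⟨
        a ⁻¹[ a≉0 ] * u'            ∎
        where open SetoidReasoning setoid

    ∼-trans : ∀ {z z' z''} → z ∼ z' → z' ∼ z'' → z ∼ z''
    ∼-trans (a , a≉0 , x'≈ , y'≈) (b , b≉0 , x''≈ , y''≈) =
      b * a , *-≉0 b≉0 a≉0 , rescale x'≈ x''≈ , rescale y'≈ y''≈
      where
      rescale : ∀ {u u' u''} → u' ≈ a * u → u'' ≈ b * u' → u'' ≈ b * a * u
      rescale u'≈ u''≈ = trans u''≈ (trans (*-congˡ u'≈) (sym (*-assoc b a _)))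

    samePoint⇒∼ : ∀ z z' → SamePoint (ρ² z) (ρ² z') → z ∼ z'
    samePoint⇒∼ (a , b) (a' , b') (γ , (δ , γδ≈𝟙 , _) , a'≈ , b'≈) = app γ 1# , γ1≉0 , at1 a'≈ , at1 b'≈
      where
      γ1≉0 : ¬ app γ 1# ≈ 0#
      γ1≉0 γ1≈0 = 1≉0 (trans (sym (γδ≈𝟙 1#)) (trans (cong δ γ1≈0) (app-0# δ)))
      at1 : ∀ {u u'} → ρ u' ≈E γ · ρ u → u' ≈ app γ 1# * u
      at1 {u} {u'} eq = trans (sym (*-identityʳ u')) (trans (eq 1#) (*-comm u _))

    ∼⇒samePoint : ∀ z z' → z ∼ z' → SamePoint (ρ² z) (ρ² z')
    ∼⇒samePoint (a , b) (a' , b') (c , c≉0 , a'≈ , b'≈) = ρ c , ρ-isUnit c≉0 , scaled a'≈ , scaled b'≈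
      where
      scaled : ∀ {u u'} → u' ≈ c * u → ρ u' ≈E ρ c · ρ u
      scaled {u} {u'} u'≈cu x = begin
        u' * x        ≈⟨ *-congʳ u'≈cu ⟩
        c * u * x     ≈⟨ *-congʳ (*-comm c u) ⟩
        u * c * x     ≈⟨ *-assoc u c x ⟩
        u * (c * x)   ∎
        where open SetoidReasoning setoid

    -‿≉0 : ∀ {x} → ¬ x ≈ 0# → ¬ - x ≈ 0#
    -‿≉0 x≉0 = x≉0 ∘ -x≈0⇒x≈0

    ∙₂-≈0₂ : ∀ {a z} → ¬ a ≈ 0# → a ∙₂ z ≈₂ 0₂ → z ≈₂ 0₂
    ∙₂-≈0₂ a≉0 (ax≈0 , ay≈0) = x*y≈0⇒y≈0 a≉0 ax≈0 , x*y≈0⇒y≈0 a≉0 ay≈0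

    image∈L : ∀ T → Admissible T → ∀ {x} → ¬ x ≈ 0# → InL T (image T x)
    image∈L T@(α , β) admissible {x} x≉0 = x≉0 ∘ image-kernel T admissible , λ distant →
      -‿≉0 1≉0 (proj₂ (invertible⇒kernel-trivial (mat α β (ρ (app α x)) (ρ (app β x))) distant (x , - 1#)
                         (cancels (app α x) , cancels (app β x))))
      where
      cancels : ∀ u → u + u * - 1# ≈ 0#
      cancels u = trans (+-congˡ (trans (sym (-‿distribʳ-* u 1#)) (-‿cong (*-identityʳ u)))) (-‿inverseʳ u)

    ∏-≉0 : ∀ {m} (v : Fin m → Carrier) → (∀ i → ¬ v i ≈ 0#) → ¬ ∏.sum v ≈ 0#
    ∏-≉0 {ℕ.zero}  v v≉0 = 1≉0
    ∏-≉0 {ℕ.suc m} v v≉0 = *-≉0 (v≉0 zero) (∏-≉0 (v ∘ suc) (v≉0 ∘ suc))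

    -- Finite fields

    module _ (n : ℕ) (card : HasCard (ℕ.suc n)) where
      private
        enum : Fin (ℕ.suc n) → Carrier
        enum = proj₁ card

        index : Carrier → Fin (ℕ.suc n)
        index x = proj₁ (proj₂ (proj₂ card) x)

        enum-index : ∀ x → enum (index x) ≈ x
        enum-index x = proj₂ (proj₂ (proj₂ card) x)

        index-injective : ∀ {x y} → index x ≡ index y → x ≈ y
        index-injective {x} {y} eq = trans (sym (enum-index x)) (trans (reflexive (≡.cong enum eq)) (enum-index y))

        index-cong : ∀ {x y} → x ≈ y → index x ≡ index y
        index-cong {x} {y} x≈y = proj₁ (proj₂ card) _ _ (trans (enum-index x) (trans x≈y (sym (enum-index y))))

        index-enum : ∀ i → index (enum i) ≡ i
        index-enum i = proj₁ (proj₂ card) _ _ (enum-index (enum i))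

      infix 4 _≟_
      _≟_ : ∀ x y → Dec (x ≈ y)
      x ≟ y = map′ index-injective index-cong (index x Fin.≟ index y)

      unit : Fin n → Carrier
      unit i = enum (punchIn (index 0#) i)

      unit≉0 : ∀ i → ¬ unit i ≈ 0#
      unit≉0 i unit≈0 = punchInᵢ≢i (index 0#) i (≡.trans (≡.sym (index-enum _)) (index-cong unit≈0))

      unit-injective : Injective _≡_ _≈_ unit
      unit-injective {i} {j} eq = punchIn-injective (index 0#) i j
        (≡.trans (≡.sym (index-enum _)) (≡.trans (index-cong eq) (index-enum _)))

      unitIndex : ∀ x → ¬ x ≈ 0# → Fin n
      unitIndex x x≉0 = punchOut {i = index 0#} {j = index x} (λ eq → x≉0 (index-injective (≡.sym eq)))

      unit-unitIndex : ∀ x (x≉0 : ¬ x ≈ 0#) → unit (unitIndex x x≉0) ≈ x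
      unit-unitIndex x x≉0 = trans (reflexive (≡.cong enum (punchIn-punchOut _))) (enum-index x)

      units≤n : ∀ {m} (a : Fin m → Carrier) → (∀ i → ¬ a i ≈ 0#) → Injective _≡_ _≈_ a → m ℕ.≤ n
      units≤n a a≉0 a-injective = injective⇒≤ {f = λ i → unitIndex (a i) (a≉0 i)} λ {i} {j} eq →
        a-injective (trans (sym (unit-unitIndex _ (a≉0 i)))
                    (trans (reflexive (≡.cong unit eq)) (unit-unitIndex _ (a≉0 j))))

      lagrange : ∀ x → ¬ x ≈ 0# → x ^ᴷ n ≈ 1#
      lagrange x x≉0 = *-cancelʳ (∏-≉0 unit unit≉0) (begin
        x ^ᴷ n * ∏.sum unit                  ≈⟨ *-congʳ (trans (^ᴷ≈×ᴹ x n) (sym (∏.sum-replicate n {x}))) ⟩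
        ∏.sum {n} (λ _ → x) * ∏.sum unit     ≈⟨ ∏.∑-distrib-+ (λ _ → x) unit ⟨
        ∏.sum (λ i → x * unit i)             ≈⟨ ∏.sum-cong-≋ (λ i → unit-scale x≉0 i) ⟨
        ∏.sum (λ i → unit (scale x≉0 i))     ≈⟨ ∏.∑-permute unit scaling ⟨
        ∏.sum unit                           ≈⟨ *-identityˡ _ ⟨
        1# * ∏.sum unit                      ∎)
        where
        open SetoidReasoning setoid
        scale : ∀ {a} → ¬ a ≈ 0# → Fin n → Fin n
        scale {a} a≉0 i = unitIndex (a * unit i) (*-≉0 a≉0 (unit≉0 i))
        unit-scale : ∀ {a} (a≉0 : ¬ a ≈ 0#) i → unit (scale a≉0 i) ≈ a * unit i
        unit-scale {a} a≉0 i = unit-unitIndex (a * unit i) (*-≉0 a≉0 (unit≉0 i))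
        scale-inverse : ∀ {a b} (a≉0 : ¬ a ≈ 0#) (b≉0 : ¬ b ≈ 0#) → a * b ≈ 1# →
                        ∀ i → scale a≉0 (scale b≉0 i) ≡ i
        scale-inverse {a} {b} a≉0 b≉0 ab≈1 i = unit-injective (begin
          unit (scale a≉0 (scale b≉0 i))   ≈⟨ unit-scale a≉0 _ ⟩
          a * unit (scale b≉0 i)           ≈⟨ *-congˡ (unit-scale b≉0 i) ⟩
          a * (b * unit i)                 ≈⟨ *-assoc a b _ ⟨
          a * b * unit i                   ≈⟨ *-congʳ ab≈1 ⟩
          1# * unit i                      ≈⟨ *-identityˡ _ ⟩
          unit i                           ∎)
        scaling : Permutation′ n
        scaling = permutation (scale x≉0) (scale (⁻¹-≉0 x≉0))
          (scale-inverse x≉0 (⁻¹-≉0 x≉0) (*-inverseʳ x x≉0))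
          (scale-inverse (⁻¹-≉0 x≉0) x≉0 (*-inverseˡ x x≉0))

      module _ {r Θ} (q≡1+r : q ≡ ℕ.suc r) (n≡Θr : n ≡ Θ ℕ.* r) where
        nonFq-is-geometric-root : ∀ x → ¬ x ≈ 0# → ¬ InFq x → geometric r Θ x ≈ 0#
        nonFq-is-geometric-root x x≉0 x∉Fq with geometric r Θ x ≟ 0#
        ... | yes G≈0 = G≈0
        ... | no G≉0  = ⊥-elim (x∉Fq (begin
          x ^ᴷ q          ≈⟨ reflexive (≡.cong (x ^ᴷ_) q≡1+r) ⟩
          x * x ^ᴷ r      ≈⟨ *-congˡ x^r≈1 ⟩
          x * 1#          ≈⟨ *-identityʳ x ⟩
          x               ∎))
          where
          open SetoidReasoning setoid
          G : Carrier
          G = geometric r Θ x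
          x^r^Θ≈1 : (x ^ᴷ r) ^ᴷ Θ ≈ 1#
          x^r^Θ≈1 = trans (^ᴷ-* x r Θ) (trans (reflexive (≡.cong (x ^ᴷ_) (≡.sym n≡Θr))) (lagrange x x≉0))
          x^r≈1 : x ^ᴷ r ≈ 1#
          x^r≈1 = *-cancelˡ G≉0 (+-cancelʳ 1# (G * x ^ᴷ r) (G * 1#) (begin
            G * x ^ᴷ r + 1#       ≈⟨ geometric-telescopes r Θ x ⟩
            G + (x ^ᴷ r) ^ᴷ Θ     ≈⟨ +-congˡ x^r^Θ≈1 ⟩
            G + 1#                ≈⟨ +-congʳ (*-identityʳ G) ⟨
            G * 1# + 1#           ∎))

      -- A unit outside F_q is a root of geometric r Θ, of degree (Θ - 1) r, so at least r units
      -- lie in F_q.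
      Fq*-family : ∀ r Θ → q ≡ ℕ.suc r → n ≡ Θ ℕ.* r →
                 Σ (Fin r → Carrier) λ a → (∀ l → ¬ a l ≈ 0#) × (∀ l → InFq (a l)) × Injective _≡_ _≈_ a
      Fq*-family ℕ.zero    _         _     _   = (λ ()) , (λ ()) , (λ ()) , λ { {()} }
      Fq*-family (ℕ.suc r) ℕ.zero    _     n≡0 = ⊥-elim (¬Fin0 (≡.subst Fin n≡0 (unitIndex 1# 1≉0)))
      Fq*-family (ℕ.suc r) (ℕ.suc Θ) q≡1+r n≡Θr =
        unit ∘ select Fq? ∘ (λ l → inject≤ l 1+r≤#Fq) ,
        (λ _ → unit≉0 _) ,
        (λ l → select-sound Fq? (inject≤ l 1+r≤#Fq)) ,
        inject≤-injective 1+r≤#Fq 1+r≤#Fq _ _ ∘ select-injective Fq? ∘ unit-injective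
        where
        Fq? : Decidable (λ i → InFq (unit i))
        Fq? i = unit i ^ᴷ q ≟ unit i

        #nonFq≤ : count (¬? ∘ Fq?) ℕ.≤ Θ ℕ.* ℕ.suc r
        #nonFq≤ = Monic-roots≤degree (Θ ℕ.* ℕ.suc r) (geometric-monic r Θ)
          (unit ∘ select (¬? ∘ Fq?)) (select-injective (¬? ∘ Fq?) ∘ unit-injective)
          (λ j → nonFq-is-geometric-root {ℕ.suc r} {ℕ.suc Θ} q≡1+r n≡Θr _ (unit≉0 _) (select-sound (¬? ∘ Fq?) j))

        1+r≤#Fq : ℕ.suc r ℕ.≤ count Fq?
        1+r≤#Fq = ℕ.+-cancelʳ-≤ (Θ ℕ.* ℕ.suc r) (ℕ.suc r) (count Fq?) (begin
          ℕ.suc r ℕ.+ Θ ℕ.* ℕ.suc r      ≡⟨ n≡Θr ⟨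
          n                              ≡⟨ count+count-¬ Fq? ⟨
          count Fq? ℕ.+ count (¬? ∘ Fq?) ≤⟨ ℕ.+-monoʳ-≤ (count Fq?) #nonFq≤ ⟩
          count Fq? ℕ.+ Θ ℕ.* ℕ.suc r    ∎)
          where open ℕ.≤-Reasoning

      infix 4 _≟₂_
      _≟₂_ : ∀ z z' → Dec (z ≈₂ z')
      (x , y) ≟₂ (x' , y') = (x ≟ x') ×-dec (y ≟ y')

      private
        pairAt : Fin (ℕ.suc n ℕ.* ℕ.suc n) → K²
        pairAt = map enum enum ∘ remQuot (ℕ.suc n)

        pairIndex : K² → Fin (ℕ.suc n ℕ.* ℕ.suc n)
        pairIndex (x , y) = combine (index x) (index y)

        pairAt-pairIndex : ∀ z → pairAt (pairIndex z) ≈₂ z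
        pairAt-pairIndex (x , y) =
          ≈₂-trans (≈₂-reflexive (≡.cong (map enum enum) (remQuot-combine (index x) (index y))))
                   (enum-index x , enum-index y)

        pairIndex-pairAt : ∀ k → pairIndex (pairAt k) ≡ k
        pairIndex-pairAt k = ≡.trans (reindex (remQuot {ℕ.suc n} (ℕ.suc n) k)) (combine-remQuot {ℕ.suc n} (ℕ.suc n) k)
          where
          reindex : ∀ p → pairIndex (map enum enum p) ≡ uncurry combine p
          reindex (i , j) = ≡.cong₂ combine (index-enum i) (index-enum j)

        pairIndex-cong : ∀ {z z'} → z ≈₂ z' → pairIndex z ≡ pairIndex z'
        pairIndex-cong (x≈ , y≈) = ≡.cong₂ combine (index-cong x≈) (index-cong y≈)

        pairIndex-injective : ∀ {z z'} → pairIndex z ≡ pairIndex z' → z ≈₂ z'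
        pairIndex-injective {z} {z'} eq = ≈₂-trans (≈₂-sym (pairAt-pairIndex z))
          (≈₂-trans (≈₂-reflexive (≡.cong pairAt eq)) (pairAt-pairIndex z'))

      K²-injective⇒surjective : ∀ {Φ} → (∀ {z z'} → Φ z ≈₂ Φ z' → z ≈₂ z') → ∀ w → ∃ λ z → Φ z ≈₂ w
      K²-injective⇒surjective {Φ} Φ-injective w =
        map pairAt pairIndex-injective (injective⇒surjective (pairIndex ∘ Φ ∘ pairAt) G-injective (pairIndex w))
        where
        G-injective : Injective _≡_ _≡_ (pairIndex ∘ Φ ∘ pairAt)
        G-injective {k} {k'} eq = ≡.trans (≡.sym (pairIndex-pairAt k))
          (≡.trans (pairIndex-cong (Φ-injective (pairIndex-injective eq))) (pairIndex-pairAt k'))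

      -- A matrix over E is determined by its action on K² (·ᵥ-injective-on-Mat), so the inverse of
      -- a bijective action, which is again F_q-linear, is the action of an inverse matrix.
      kernel-trivial⇒invertible : ∀ M → (∀ z → z ·ᵥ M ≈₂ 0₂ → z ≈₂ 0₂) → InGL₂ M
      kernel-trivial⇒invertible M trivial =
        N , ·ᵥ-injective-on-Mat {M ⊗ N} {I₂} M⊗N≈I₂ , ·ᵥ-injective-on-Mat {N ⊗ M} {I₂} N⊗M≈I₂
        where
        open SetoidReasoning K²-setoid
        Φ-linear : IsLinear₂ (_·ᵥ M)
        Φ-linear = ·ᵥ-isLinear₂ M
        Φ-injective : ∀ {z z'} → z ·ᵥ M ≈₂ z' ·ᵥ M → z ≈₂ z'
        Φ-injective = kernel-trivial⇒injective Φ-linear trivial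
        Ψ : K² → K²
        Ψ w = proj₁ (K²-injective⇒surjective Φ-injective w)
        ΦΨ≈id : ∀ w → Ψ w ·ᵥ M ≈₂ w
        ΦΨ≈id w = proj₂ (K²-injective⇒surjective Φ-injective w)
        Ψ-linear : IsLinear₂ Ψ
        Ψ-linear = section-isLinear₂ Φ-linear Φ-injective ΦΨ≈id
        N : Mat
        N = matrixOf Ψ-linear
        M⊗N≈I₂ : ∀ z → z ·ᵥ (M ⊗ N) ≈₂ z ·ᵥ I₂
        M⊗N≈I₂ z = begin
          z ·ᵥ (M ⊗ N)     ≈⟨ ·ᵥ-⊗ M N z ⟩
          z ·ᵥ M ·ᵥ N      ≈⟨ ·ᵥ-matrixOf Ψ-linear (z ·ᵥ M) ⟩
          Ψ (z ·ᵥ M)       ≈⟨ Φ-injective (ΦΨ≈id (z ·ᵥ M)) ⟩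
          z                ≈⟨ ·ᵥ-I₂ z ⟨
          z ·ᵥ I₂          ∎
        N⊗M≈I₂ : ∀ z → z ·ᵥ (N ⊗ M) ≈₂ z ·ᵥ I₂
        N⊗M≈I₂ z = begin
          z ·ᵥ (N ⊗ M)     ≈⟨ ·ᵥ-⊗ N M z ⟩
          z ·ᵥ N ·ᵥ M      ≈⟨ IsLinear₂.cong₂ Φ-linear (·ᵥ-matrixOf Ψ-linear z) ⟩
          Ψ z ·ᵥ M         ≈⟨ ΦΨ≈id z ⟩
          z                ≈⟨ ·ᵥ-I₂ z ⟨
          z ·ᵥ I₂          ∎

      singular⇒kernel : ∀ M → ¬ InGL₂ M → ∃ λ z → ¬ z ≈₂ 0₂ × z ·ᵥ M ≈₂ 0₂
      singular⇒kernel M singular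
        with any? (λ k → ¬? (pairAt k ≟₂ 0₂) ×-dec (pairAt k ·ᵥ M ≟₂ 0₂))
      ... | yes (k , found) = pairAt k , found
      ... | no none = ⊥-elim (singular (kernel-trivial⇒invertible M trivial))
        where
        trivial : ∀ z → z ·ᵥ M ≈₂ 0₂ → z ≈₂ 0₂
        trivial z z·M≈0 = decidable-stable (z ≟₂ 0₂) λ z≉0 → none (pairIndex z ,
          (z≉0 ∘ ≈₂-trans (≈₂-sym (pairAt-pairIndex z))) ,
          ≈₂-trans (IsLinear₂.cong₂ (·ᵥ-isLinear₂ M) (pairAt-pairIndex z)) z·M≈0)

      ∙₂-cancelʳ : ∀ {a b z} → ¬ z ≈₂ 0₂ → a ∙₂ z ≈₂ b ∙₂ z → a ≈ b
      ∙₂-cancelʳ {a} {b} z≉0 (ax≈bx , ay≈by) = decidable-stable (a ≟ b) λ a≉b →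
        z≉0 (x*z≈y*z⇒x≉y⇒z≈0 ax≈bx a≉b , x*z≈y*z⇒x≉y⇒z≈0 ay≈by a≉b)

      InL⇒image : ∀ T → Admissible T → ∀ {P} → InL T P → ∃ λ x → ¬ x ≈ 0# × image T x ∼ P
      InL⇒image T@(α , β) admissible {a , b} (P≉0 , non-distant)
        with singular⇒kernel (mat α β (ρ a) (ρ b)) non-distant
      ... | (x , y) , z≉0 , (α-eq , β-eq) = x , x≉0 , ∼-sym (- y , -‿≉0 y≉0 , image≈)
        where
        solve-for : ∀ {u v} → u + v * y ≈ 0# → u ≈ - y * v
        solve-for {u} {v} eq = trans (+-inverseˡ-unique _ _ eq) (trans (-‿cong (*-comm v y)) (-‿distribˡ-* y v))
        image≈ : image T x ≈₂ (- y) ∙₂ (a , b)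
        image≈ = solve-for α-eq , solve-for β-eq
        y≉0 : ¬ y ≈ 0#
        y≉0 y≈0 = z≉0 (image-kernel T admissible (≈₂-trans image≈ (∙₂-zeroˡ (trans (-‿cong y≈0) -0#≈0#))) ,
                       y≈0)
        x≉0 : ¬ x ≈ 0#
        x≉0 x≈0 = P≉0 (∙₂-≈0₂ (-‿≉0 y≉0) (≈₂-trans (≈₂-sym image≈) (image-0# T x≈0)))

      -- Scattered points

      module ScatteredPoint (T : Pair) (admissible : Admissible T) (Θ : ℕ) (scattered : CardL T Θ) where
        private
          pt : Fin Θ → Carrier × Carrier
          pt = proj₁ scattered

          pt∈L : ∀ i → InL T (pt i)
          pt∈L = proj₁ (proj₂ scattered)

        ∼pt-unique : ∀ {P i j} → P ∼ pt i → P ∼ pt j → i ≡ j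
        ∼pt-unique {P} {i} {j} P∼i P∼j =
          proj₁ (proj₂ (proj₂ scattered)) i j (∼⇒samePoint (pt i) (pt j) (∼-trans (∼-sym P∼i) P∼j))

        pointOf : ∀ x → ¬ x ≈ 0# → Fin Θ
        pointOf x x≉0 = proj₁ (proj₂ (proj₂ (proj₂ scattered)) (image T x) (image∈L T admissible x≉0))

        image∼pointOf : ∀ x (x≉0 : ¬ x ≈ 0#) → image T x ∼ pt (pointOf x x≉0)
        image∼pointOf x x≉0 = samePoint⇒∼ _ _
          (proj₂ (proj₂ (proj₂ (proj₂ scattered)) (image T x) (image∈L T admissible x≉0)))

        module _ (r : ℕ) (q≡1+r : q ≡ ℕ.suc r) (n≡Θr : n ≡ Θ ℕ.* r) where
          -- Otherwise x and the Θ r products a l * rep i would be 1 + Θ r = n + 1 distinct units.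
          proportional⇒Fq : ∀ {x y c} → ¬ x ≈ 0# → ¬ y ≈ 0# → image T x ≈₂ c ∙₂ image T y → InFq c
          proportional⇒Fq {x} {y} {c} x≉0 y≉0 x≈cy = decidable-stable (c ^ᴷ q ≟ c) λ c∉Fq →
            ℕ.<-irrefl (≡.sym n≡Θr) (units≤n family family≉0 (family-injective c∉Fq))
            where
            c≉0 : ¬ c ≈ 0#
            c≉0 c≈0 = x≉0 (image-kernel T admissible (≈₂-trans x≈cy (∙₂-zeroˡ c≈0)))

            i₀ : Fin Θ
            i₀ = pointOf y y≉0

            image-x∼i₀ : image T x ∼ pt i₀
            image-x∼i₀ = ∼-trans (∼-sym (c , c≉0 , x≈cy)) (image∼pointOf y y≉0)

            representative : ∀ i → Dec (i ≡ i₀) → ∃ λ z → ¬ z ≈ 0# × image T z ∼ pt i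
            representative i (yes ≡.refl) = y , y≉0 , image∼pointOf y y≉0
            representative i (no _)       = InL⇒image T admissible (pt∈L i)

            representative-i₀ : ∀ {i} (d : Dec (i ≡ i₀)) → i ≡ i₀ → proj₁ (representative i d) ≈ y
            representative-i₀ (yes ≡.refl) _    = refl
            representative-i₀ (no i≢i₀)    i≡i₀ = ⊥-elim (i≢i₀ i≡i₀)

            rep : Fin Θ → Carrier
            rep i = proj₁ (representative i (i Fin.≟ i₀))

            rep≉0 : ∀ i → ¬ rep i ≈ 0#
            rep≉0 i = proj₁ (proj₂ (representative i (i Fin.≟ i₀)))

            rep∼pt : ∀ i → image T (rep i) ∼ pt i
            rep∼pt i = proj₂ (proj₂ (representative i (i Fin.≟ i₀)))

            Fq* : Σ (Fin r → Carrier) λ a → (∀ l → ¬ a l ≈ 0#) × (∀ l → InFq (a l)) × Injective _≡_ _≈_ a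
            Fq* = Fq*-family r Θ q≡1+r n≡Θr

            a : Fin r → Carrier
            a = proj₁ Fq*

            member : Fin Θ × Fin r → Carrier
            member (i , l) = a l * rep i

            member∼pt : ∀ i l → image T (member (i , l)) ∼ pt i
            member∼pt i l = ∼-trans
              (∼-sym (a l , proj₁ (proj₂ Fq*) l , image-homogeneous T (a l) (rep i) (proj₁ (proj₂ (proj₂ Fq*)) l)))
              (rep∼pt i)

            member-injective : Injective _≡_ _≈_ member
            member-injective {i , l} {i' , l'} eq = ≡.cong₂ _,_ i≡i' (proj₂ (proj₂ (proj₂ Fq*))
                (*-cancelʳ (rep≉0 i) (trans eq (*-congˡ (reflexive (≡.cong rep (≡.sym i≡i')))))))
              where
              i≡i' : i ≡ i'
              i≡i' = ∼pt-unique (member∼pt i l) (∼-trans (≈₂⇒∼ (image-cong T eq)) (member∼pt i' l'))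

            x≈member⇒c∈Fq : ∀ p → x ≈ member p → InFq c
            x≈member⇒c∈Fq (i , l) x≈ = InFq-resp al≈c (proj₁ (proj₂ (proj₂ Fq*)) l)
              where
              i≡i₀ : i ≡ i₀
              i≡i₀ = ∼pt-unique (∼-trans (≈₂⇒∼ (image-cong T x≈)) (member∼pt i l)) image-x∼i₀
              x≈aly : image T x ≈₂ a l ∙₂ image T y
              x≈aly = ≈₂-trans (image-cong T (trans x≈ (*-congˡ (representative-i₀ (i Fin.≟ i₀) i≡i₀))))
                               (image-homogeneous T (a l) y (proj₁ (proj₂ (proj₂ Fq*)) l))
              al≈c : a l ≈ c
              al≈c = ∙₂-cancelʳ (y≉0 ∘ image-kernel T admissible) (≈₂-trans (≈₂-sym x≈aly) x≈cy)

            family : Fin (ℕ.suc (Θ ℕ.* r)) → Carrier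
            family zero    = x
            family (suc k) = member (remQuot {Θ} r k)

            family≉0 : ∀ k → ¬ family k ≈ 0#
            family≉0 zero    = x≉0
            family≉0 (suc k) = *-≉0 (proj₁ (proj₂ Fq*) (proj₂ (remQuot {Θ} r k))) (rep≉0 (proj₁ (remQuot {Θ} r k)))

            family-injective : ¬ InFq c → Injective _≡_ _≈_ family
            family-injective c∉Fq {zero}  {zero}  _  = ≡.refl
            family-injective c∉Fq {zero}  {suc k'} eq = ⊥-elim (c∉Fq (x≈member⇒c∈Fq (remQuot {Θ} r k') eq))
            family-injective c∉Fq {suc k} {zero}  eq = ⊥-elim (c∉Fq (x≈member⇒c∈Fq (remQuot {Θ} r k) (sym eq)))
            family-injective c∉Fq {suc k} {suc k'} eq = ≡.cong suc (remQuot-injective r (member-injective eq))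

          distant-⟨⟩ : ∀ {h k h⁻¹} → ¬ k ≈ 0# → h * h⁻¹ ≈ 1# → ¬ InFq (h⁻¹ * k) →
                       Distant (T ⟨ h ⟩) (T ⟨ k ⟩)
          distant-⟨⟩ {h} {k} {h⁻¹} k≉0 hh⁻¹≈1 l∉Fq = kernel-trivial⇒invertible M trivial
            where
            M : Mat
            M = mat (proj₁ T · ρ h) (proj₂ T · ρ h) (proj₁ T · ρ k) (proj₂ T · ρ k)
            l≉0 : ¬ h⁻¹ * k ≈ 0#
            l≉0 = *-≉0 (x*y≈1⇒y≉0 hh⁻¹≈1) k≉0
            trivial : ∀ z → z ·ᵥ M ≈₂ 0₂ → z ≈₂ 0₂
            trivial (x , y) kernel = decidable-stable ((x , y) ≟₂ 0₂) λ z≉0 →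
              let -y≉0 : ¬ - y ≈ 0#
                  -y≉0 -y≈0 = z≉0 (image-kernel T admissible (≈₂-trans image≈ (∙₂-zeroʳ (image-0# T -y≈0))) ,
                                   -x≈0⇒x≈0 -y≈0)
                  x≉0 : ¬ x ≈ 0#
                  x≉0 x≈0 = -y≉0 (image-kernel T admissible
                              (∙₂-≈0₂ l≉0 (≈₂-trans (≈₂-sym image≈) (image-0# T x≈0))))
              in l∉Fq (proportional⇒Fq x≉0 -y≉0 image≈)
              where
              image≈ : image T x ≈₂ (h⁻¹ * k) ∙₂ image T (- y)
              image≈ = image-⟨⟩-kernel (proj₁ T) (proj₂ T) hh⁻¹≈1 kernel

primePower⇒≡1+ : ∀ {q} → IsPrimePower q → ∃ λ r → q ≡ ℕ.suc r
primePower⇒≡1+ (p , k , p-prime , _ , ≡.refl) =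
  ℕ.pred (p ^ k) , ≡.sym (ℕ.suc-pred (p ^ k) {{ℕ.m^n≢0 p k {{prime⇒nonZero p-prime}}}})

θ-identity : ∀ r t → ℕ.suc r ^ t ≡ ℕ.suc (θ (ℕ.suc r) t ℕ.* r)
θ-identity r ℕ.zero    = ≡.refl
θ-identity r (ℕ.suc t) = begin
  ℕ.suc r ℕ.* ℕ.suc r ^ t                ≡⟨ ≡.cong (ℕ.suc r ℕ.*_) (θ-identity r t) ⟩
  ℕ.suc r ℕ.* ℕ.suc (Θ ℕ.* r)            ≡⟨ solve 2 (λ r Θ → (con 1 :+ r) :* (con 1 :+ Θ :* r) :=
                                                      con 1 :+ ((con 1 :+ Θ :* r) :+ Θ) :* r) ≡.refl r Θ ⟩
  ℕ.suc ((ℕ.suc (Θ ℕ.* r) ℕ.+ Θ) ℕ.* r)  ≡⟨ ≡.cong (λ x → ℕ.suc ((x ℕ.+ Θ) ℕ.* r)) (θ-identity r t) ⟨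
  ℕ.suc ((ℕ.suc r ^ t ℕ.+ Θ) ℕ.* r)      ∎
  where
  open ≡.≡-Reasoning
  open +-*-Solver
  Θ : ℕ
  Θ = θ (ℕ.suc r) t

q^t≡1+θ·r : ∀ {q r} t → q ≡ ℕ.suc r → q ^ t ≡ ℕ.suc (θ q t ℕ.* r)
q^t≡1+θ·r {r = r} t ≡.refl = θ-identity r t

proposition7 : ∀ {c ℓ} (K : CommutativeRing c ℓ) (q t : ℕ) →
    let open CommutativeRing K
        open Setup K q
    in IsPrimePower q → t ≥ 2 → IsField → HasCard (q ^ t) →
       ∀ (T : Pair) → Admissible T → ¬ InPGF T →
         (∀ h k h⁻¹ → ¬ (h ≈ 0#) → ¬ (k ≈ 0#) → h * h⁻¹ ≈ 1# →
            InFq (h⁻¹ * k) → SamePoint (T ⟨ h ⟩) (T ⟨ k ⟩))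
       × (Scattered t T →
          ∀ h k h⁻¹ → ¬ (h ≈ 0#) → ¬ (k ≈ 0#) → h * h⁻¹ ≈ 1# →
            ¬ InFq (h⁻¹ * k) → Distant (T ⟨ h ⟩) (T ⟨ k ⟩))
proposition7 K q t q-primePower _ isField card T admissible _ =
  (λ _ _ _ _ k≉0 hh⁻¹≈1 → samePoint-⟨⟩ K q isField T k≉0 hh⁻¹≈1) ,
  (λ scattered _ _ _ _ k≉0 hh⁻¹≈1 →
     ScatteredPoint.distant-⟨⟩ K q isField n card′ T admissible (θ q t) scattered r q≡1+r ≡.refl k≉0 hh⁻¹≈1)
  where
  open Setup K q using (HasCard)
  r : ℕ
  r = proj₁ (primePower⇒≡1+ q-primePower)
  q≡1+r : q ≡ ℕ.suc r
  q≡1+r = proj₂ (primePower⇒≡1+ q-primePower)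
  n : ℕ
  n = θ q t ℕ.* r
  card′ : HasCard (ℕ.suc n)
  card′ = ≡.subst HasCard (q^t≡1+θ·r t q≡1+r) card
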